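{- Let $\pi\in\mathsf{S}_n$, let $k\ge1$ and let $b_1,\dots,b_k$ be distinct elements of $\{1,\dots,n-1\}$. Then $\mathsf{SP}^*(\pi)=(b_1,b_2,\dots,b_k)$ if and only if all of the following hold: (1) $\pi(1)=b_k+1$; (2) $\pi(n)=b_1$; (3) for every $j\in\{2,3,\dots,k\}$, the entry $b_j$ appears in the one-line notation of $\pi$ immediately to the left of the entry $b_{j-1}+1$.
   Context: $\mathsf{S}_n$ is the set of permutations of $\{1,\dots,n\}$; $[a_1\cdots a_n]$ is one-line notation ($\pi(i)=a_i$); cycles $(c_1\cdots c_k)$ send $c_1\mapsto\cdots\mapsto c_k\mapsto c_1$; composition is right-to-left. For $\pi=[a_1\cdots a_n]$ let $X_n=(0\;1\;\cdots\;n)$, $Y_\pi=(0\;a_n\;a_{n-1}\;\cdots\;a_1)$, $C_\pi=Y_\pi\circ X_n$ (permutations of $\{0,\dots,n\}$). If $0$ and $n$ lie in the same cycle of $C_\pi$, written $(0\;u_1\cdots u_j\;n\;b_1\;b_2\cdots b_k)$, the ordered strategic pile is the list $\mathsf{SP}^*(\pi)=(b_1,\dots,b_k)$ (order of appearance after $n$ in that cycle); otherwise it is the empty list. -}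

module Defs where

open import Data.Nat using (ℕ; zero; suc; _≤_; _<_)
open import Data.Fin using (Fin; zero; suc; toℕ; fromℕ; _≟_)
open import Data.Fin.Permutation using (Permutation′; _⟨$⟩ʳ_)
open import Data.List using (List; []; _∷_; map; reverse; allFin)
open import Data.Maybe using (Maybe; just; nothing)
open import Relation.Nullary using (yes; no)

cycleFrom : ∀ {m} → Fin m → Fin m → List (Fin m) → Fin m → Fin m
cycleFrom c₀ c [] x with x ≟ c
... | yes _ = c₀
... | no  _ = x
cycleFrom c₀ c (d ∷ cs) x with x ≟ c
... | yes _ = d
... | no  _ = cycleFrom c₀ d cs x

cycle : ∀ {m} → List (Fin m) → Fin m → Fin m
cycle [] x = x
cycle (c ∷ cs) x = cycleFrom c c cs x

-- A permutation π ∈ S_n is a bijection of Fin n; position i (0-based) stands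
-- for i+1 and value v stands for v+1.  One-line entry a_{i+1} as an element
-- of {0,…,n} (= Fin (suc n)):
entryF : ∀ {n} → Permutation′ n → Fin n → Fin (suc n)
entryF π i = suc (π ⟨$⟩ʳ i)

-- One-line notation as a function on ℕ positions: oneLine π i = a_i = π(i)
-- for 1 ≤ i ≤ n (junk value 0 outside that range).
oneLineAux : ∀ {n} → (Fin n → ℕ) → ℕ → ℕ
oneLineAux {zero} f i = 0
oneLineAux {suc n} f zero = 0
oneLineAux {suc n} f (suc zero) = f zero
oneLineAux {suc n} f (suc (suc i)) = oneLineAux {n} (λ j → f (suc j)) (suc i)

oneLine : ∀ {n} → Permutation′ n → ℕ → ℕ
oneLine π = oneLineAux (λ i → toℕ (entryF π i))

Xn : (n : ℕ) → Fin (suc n) → Fin (suc n)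
Xn n = cycle (allFin (suc n))

Yπ : ∀ {n} → Permutation′ n → Fin (suc n) → Fin (suc n)
Yπ {n} π = cycle (zero ∷ reverse (map (entryF π) (allFin n)))

Cπ : ∀ {n} → Permutation′ n → Fin (suc n) → Fin (suc n)
Cπ π x = Yπ π (Xn _ x)

walkTo0 : ∀ {m} → (Fin (suc m) → Fin (suc m)) → ℕ → Fin (suc m) → Maybe (List (Fin (suc m)))
walkTo0 f zero x = nothing
walkTo0 f (suc fuel) zero = just []
walkTo0 f (suc fuel) (suc y) with walkTo0 f fuel (f (suc y))
... | just l = just (suc y ∷ l)
... | nothing = nothing

-- Fuel n+1 suffices since all cycles have length ≤ n+1.
SPstar : ∀ {n} → Permutation′ n → List ℕ
SPstar {n} π with walkTo0 (Cπ π) (suc n) (Cπ π (fromℕ n))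
... | just l = map toℕ l
... | nothing = []

-- For v < n we have X_n(v) = v + 1, and Y_π sends a_1 to 0 and every other entry
-- a_{i+1} to its left neighbour a_i; moreover C_π(n) = Y_π(0) = a_n.  Hence the
-- cycle of C_π through n reads n ↦ a_n ↦ ⋯, and a step v ↦ w (w ≠ 0) happens
-- exactly when w sits immediately left of v + 1, while v ↦ 0 happens exactly
-- when a_1 = v + 1.  So SP*(π) = (b_1, …, b_k) says precisely that π(n) = b_1,
-- that each b_j is left of b_{j-1} + 1, and that π(1) = b_k + 1.  The fuel
-- n + 1 of the walk is never exhausted, since the b_j are distinct and fewer than n.
module Submission where

open import Defs
open import Data.Fin using (Fin; zero; suc; toℕ; fromℕ; fromℕ<; inject₁; opposite; _≟_)
open import Data.Fin.Permutation using (Permutation′; _⟨$⟩ʳ_; _⟨$⟩ˡ_; inverseˡ; inverseʳ)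
open import Data.Fin.Properties
  using (toℕ-injective; suc-injective; toℕ-fromℕ; toℕ-fromℕ<; toℕ-inject₁; toℕ<n;
         opposite-involutive; injective⇒≤; 0≢1+n)
open import Data.List using (List; []; _∷_; _∷ʳ_; tabulate; map; reverse; length)
open import Data.List.Properties
  using (map-tabulate; tabulate-cong; unfold-reverse; map-injective; length-tabulate)
open import Data.Maybe using (just; nothing)
open import Data.Nat using (ℕ; zero; suc; _≤_; _<_; _∸_; z≤n; s≤s)
open import Data.Nat.Properties using (≤-trans)
open import Data.Product using (_×_; _,_; proj₁; proj₂; ∃)
open import Function using (_∘_)
open import Function.Bundles using (_⇔_; mk⇔; Equivalence)
open import Function.Definitions using (Injective)
open import Function.Properties.Equivalence using () renaming (trans to ⇔-trans)
open import Relation.Binary.PropositionalEquality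
open import Relation.Nullary using (yes; no; contradiction)

open Equivalence using (to; from)

cycleFrom-[]-head : ∀ {M} (c₀ c : Fin M) → cycleFrom c₀ c [] c ≡ c₀
cycleFrom-[]-head c₀ c with c ≟ c
... | yes _  = refl
... | no c≢c = contradiction refl c≢c

cycleFrom-∷-head : ∀ {M} (c₀ c d : Fin M) cs → cycleFrom c₀ c (d ∷ cs) c ≡ d
cycleFrom-∷-head c₀ c d cs with c ≟ c
... | yes _  = refl
... | no c≢c = contradiction refl c≢c

cycleFrom-∷-other : ∀ {M} {c₀ c d x : Fin M} cs → x ≢ c →
                    cycleFrom c₀ c (d ∷ cs) x ≡ cycleFrom c₀ d cs x
cycleFrom-∷-other {c = c} {x = x} cs x≢c with x ≟ c
... | yes x≡c = contradiction x≡c x≢c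
... | no _    = refl

module _ {M : ℕ} (c₀ : Fin M) where

  cycleFrom-tabulate-inject₁ : ∀ {k} (g : Fin (suc k) → Fin M) → Injective _≡_ _≡_ g →
    ∀ j → cycleFrom c₀ (g zero) (tabulate (g ∘ suc)) (g (inject₁ j)) ≡ g (suc j)
  cycleFrom-tabulate-inject₁ g g-inj zero = cycleFrom-∷-head c₀ (g zero) (g (suc zero)) _
  cycleFrom-tabulate-inject₁ g g-inj (suc j) =
    trans (cycleFrom-∷-other _ (λ eq → 0≢1+n (sym (g-inj eq))))
          (cycleFrom-tabulate-inject₁ (g ∘ suc) (λ eq → suc-injective (g-inj eq)) j)

  cycleFrom-tabulate-fromℕ : ∀ {k} (g : Fin (suc k) → Fin M) → Injective _≡_ _≡_ g →
    cycleFrom c₀ (g zero) (tabulate (g ∘ suc)) (g (fromℕ k)) ≡ c₀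
  cycleFrom-tabulate-fromℕ {zero} g g-inj = cycleFrom-[]-head c₀ (g zero)
  cycleFrom-tabulate-fromℕ {suc k} g g-inj =
    trans (cycleFrom-∷-other _ (λ eq → 0≢1+n (sym (g-inj eq))))
          (cycleFrom-tabulate-fromℕ (g ∘ suc) (λ eq → suc-injective (g-inj eq)))

module _ {M k : ℕ} {g : Fin (suc k) → Fin M} (g-inj : Injective _≡_ _≡_ g) where

  cycle-tabulate-inject₁ : ∀ j → cycle (tabulate g) (g (inject₁ j)) ≡ g (suc j)
  cycle-tabulate-inject₁ = cycleFrom-tabulate-inject₁ (g zero) g g-inj

  cycle-tabulate-fromℕ : cycle (tabulate g) (g (fromℕ k)) ≡ g zero
  cycle-tabulate-fromℕ = cycleFrom-tabulate-fromℕ (g zero) g g-inj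

Xn-inject₁ : ∀ n (i : Fin n) → Xn n (inject₁ i) ≡ suc i
Xn-inject₁ n = cycle-tabulate-inject₁ (λ eq → eq)

Xn-fromℕ : ∀ n → Xn n (fromℕ n) ≡ zero
Xn-fromℕ n = cycle-tabulate-fromℕ (λ eq → eq)

opposite-fromℕ : ∀ n → opposite (fromℕ n) ≡ zero
opposite-fromℕ zero    = refl
opposite-fromℕ (suc n) = cong inject₁ (opposite-fromℕ n)

opposite-inject₁ : ∀ {n} (i : Fin n) → opposite (inject₁ i) ≡ suc (opposite i)
opposite-inject₁ {suc n} zero    = refl
opposite-inject₁ {suc n} (suc i) = cong inject₁ (opposite-inject₁ i)

tabulate-∷ʳ : ∀ {A : Set} {n} (f : Fin (suc n) → A) →
              tabulate f ≡ tabulate (f ∘ inject₁) ∷ʳ f (fromℕ n)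
tabulate-∷ʳ {n = zero}  f = refl
tabulate-∷ʳ {n = suc n} f = cong (f zero ∷_) (tabulate-∷ʳ (f ∘ suc))

reverse-tabulate : ∀ {A : Set} {n} (f : Fin n → A) → reverse (tabulate f) ≡ tabulate (f ∘ opposite)
reverse-tabulate {n = zero}  f = refl
reverse-tabulate {n = suc n} f = begin
  reverse (f zero ∷ tabulate (f ∘ suc))          ≡⟨ unfold-reverse (f zero) (tabulate (f ∘ suc)) ⟩
  reverse (tabulate (f ∘ suc)) ∷ʳ f zero         ≡⟨ cong (_∷ʳ f zero) (reverse-tabulate (f ∘ suc)) ⟩
  tabulate (f ∘ suc ∘ opposite) ∷ʳ f zero
    ≡⟨ cong₂ _∷ʳ_ (tabulate-cong (cong f ∘ sym ∘ opposite-inject₁)) (cong f (sym (opposite-fromℕ n))) ⟩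
  tabulate (f ∘ opposite ∘ inject₁) ∷ʳ f (opposite (fromℕ n))
                                                 ≡⟨ tabulate-∷ʳ (f ∘ opposite) ⟨
  tabulate (f ∘ opposite)                        ∎
  where open ≡-Reasoning

entryF-injective : ∀ {n} (π : Permutation′ n) → Injective _≡_ _≡_ (entryF π)
entryF-injective π {p} {q} eq = begin
  p                         ≡⟨ inverseˡ π ⟨
  π ⟨$⟩ˡ (π ⟨$⟩ʳ p)          ≡⟨ cong (π ⟨$⟩ˡ_) (suc-injective eq) ⟩
  π ⟨$⟩ˡ (π ⟨$⟩ʳ q)          ≡⟨ inverseˡ π ⟩
  q                         ∎
  where open ≡-Reasoning

oneLineAux-suc-toℕ : ∀ {n} (g : Fin n → ℕ) i → oneLineAux g (suc (toℕ i)) ≡ g i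
oneLineAux-suc-toℕ {suc n} g zero    = refl
oneLineAux-suc-toℕ {suc n} g (suc i) = oneLineAux-suc-toℕ (g ∘ suc) i

oneLine-entryF : ∀ {n} (π : Permutation′ n) p → oneLine π (suc (toℕ p)) ≡ toℕ (entryF π p)
oneLine-entryF π = oneLineAux-suc-toℕ (toℕ ∘ entryF π)

module _ {n : ℕ} (π : Permutation′ (suc n)) where

  Yπ-points : Fin (suc (suc n)) → Fin (suc (suc n))
  Yπ-points zero    = zero
  Yπ-points (suc i) = entryF π (opposite i)

  Yπ-points-injective : Injective _≡_ _≡_ Yπ-points
  Yπ-points-injective {zero}  {zero}  _  = refl
  Yπ-points-injective {suc i} {suc j} eq = cong suc (begin
    i                         ≡⟨ opposite-involutive i ⟨
    opposite (opposite i)     ≡⟨ cong opposite (entryF-injective π eq) ⟩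
    opposite (opposite j)     ≡⟨ opposite-involutive j ⟩
    j                         ∎)
    where open ≡-Reasoning

  Yπ-cycle-tabulate : ∀ x → Yπ π x ≡ cycle (tabulate Yπ-points) x
  Yπ-cycle-tabulate x = cong (λ L → cycle (zero ∷ L) x)
    (trans (cong reverse (map-tabulate (λ i → i) (entryF π))) (reverse-tabulate (entryF π)))

  Yπ-zero : Yπ π zero ≡ entryF π (fromℕ n)
  Yπ-zero = trans (Yπ-cycle-tabulate zero) (cycle-tabulate-inject₁ Yπ-points-injective zero)

  Yπ-entryF-zero : Yπ π (entryF π zero) ≡ zero
  Yπ-entryF-zero = begin
    Yπ π (entryF π zero)                               ≡⟨ cong (Yπ π ∘ entryF π) (opposite-fromℕ n) ⟨
    Yπ π (Yπ-points (fromℕ (suc n)))                   ≡⟨ Yπ-cycle-tabulate _ ⟩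
    cycle (tabulate Yπ-points) (Yπ-points (fromℕ (suc n))) ≡⟨ cycle-tabulate-fromℕ Yπ-points-injective ⟩
    zero                                               ∎
    where open ≡-Reasoning

  Yπ-entryF-suc : ∀ q → Yπ π (entryF π (suc q)) ≡ entryF π (inject₁ q)
  Yπ-entryF-suc q = begin
    Yπ π (entryF π (suc q))                            ≡⟨ cong (Yπ π ∘ entryF π) position ⟩
    Yπ π (Yπ-points (inject₁ (suc (opposite q))))      ≡⟨ Yπ-cycle-tabulate _ ⟩
    cycle (tabulate Yπ-points) (Yπ-points (inject₁ (suc (opposite q))))
                                                       ≡⟨ cycle-tabulate-inject₁ Yπ-points-injective (suc (opposite q)) ⟩
    entryF π (inject₁ (opposite (opposite q)))         ≡⟨ cong (entryF π ∘ inject₁) (opposite-involutive q) ⟩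
    entryF π (inject₁ q)                               ∎
    where
    open ≡-Reasoning
    position : suc q ≡ opposite (inject₁ (opposite q))
    position = sym (trans (opposite-inject₁ (opposite q)) (cong suc (opposite-involutive q)))

  entryF-preimage : ∀ v → entryF π (π ⟨$⟩ˡ v) ≡ suc v
  entryF-preimage v = cong suc (inverseʳ π)

  Yπ-suc≡zero⇔ : ∀ v → Yπ π (suc v) ≡ zero ⇔ entryF π zero ≡ suc v
  Yπ-suc≡zero⇔ v = mk⇔ ⇒ λ e → trans (cong (Yπ π) (sym e)) Yπ-entryF-zero
    where
    ⇒ : Yπ π (suc v) ≡ zero → entryF π zero ≡ suc v
    ⇒ Y≡0 with π ⟨$⟩ˡ v | entryF-preimage v
    ... | zero  | e≡ = e≡
    ... | suc q | e≡ with trans (sym (Yπ-entryF-suc q)) (trans (cong (Yπ π) e≡) Y≡0)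
    ...   | ()

  Yπ-suc≡⇔ : ∀ {v w} → w ≢ zero →
    Yπ π (suc v) ≡ w ⇔ ∃ λ q → entryF π (inject₁ q) ≡ w × entryF π (suc q) ≡ suc v
  Yπ-suc≡⇔ {v} {w} w≢0 = mk⇔ ⇒ λ (q , left , right) →
    trans (cong (Yπ π) (sym right)) (trans (Yπ-entryF-suc q) left)
    where
    ⇒ : Yπ π (suc v) ≡ w → ∃ λ q → entryF π (inject₁ q) ≡ w × entryF π (suc q) ≡ suc v
    ⇒ Y≡w with π ⟨$⟩ˡ v | entryF-preimage v
    ... | zero  | e≡ = contradiction (trans (sym Y≡w) (trans (cong (Yπ π) (sym e≡)) Yπ-entryF-zero)) w≢0
    ... | suc q | e≡ = q , trans (sym (Yπ-entryF-suc q)) (trans (cong (Yπ π) e≡) Y≡w) , e≡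

  oneLine-inject₁ : ∀ q → oneLine π (suc (toℕ q)) ≡ toℕ (entryF π (inject₁ q))
  oneLine-inject₁ q = trans (cong (oneLine π ∘ suc) (sym (toℕ-inject₁ q))) (oneLine-entryF π (inject₁ q))

  adjacent⇔ : ∀ {w u} →
    (∃ λ q → entryF π (inject₁ q) ≡ w × entryF π (suc q) ≡ u) ⇔
    (∃ λ i → 1 ≤ i × i < suc n × oneLine π i ≡ toℕ w × oneLine π (suc i) ≡ toℕ u)
  adjacent⇔ {w} {u} = mk⇔ ⇒ ⇐
    where
    ⇒ : (∃ λ q → entryF π (inject₁ q) ≡ w × entryF π (suc q) ≡ u) →
        ∃ λ i → 1 ≤ i × i < suc n × oneLine π i ≡ toℕ w × oneLine π (suc i) ≡ toℕ u
    ⇒ (q , left , right) = suc (toℕ q) , s≤s z≤n , s≤s (toℕ<n q) ,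
      trans (oneLine-inject₁ q) (cong toℕ left) , trans (oneLine-entryF π (suc q)) (cong toℕ right)
    ⇐ : (∃ λ i → 1 ≤ i × i < suc n × oneLine π i ≡ toℕ w × oneLine π (suc i) ≡ toℕ u) →
        ∃ λ q → entryF π (inject₁ q) ≡ w × entryF π (suc q) ≡ u
    ⇐ (suc i , _ , s≤s i<n , left , right) with fromℕ< i<n | toℕ-fromℕ< i<n
    ... | q | refl = q , toℕ-injective (trans (sym (oneLine-inject₁ q)) left)
                       , toℕ-injective (trans (sym (oneLine-entryF π (suc q))) right)

  Cπ-fromℕ≡⇔ : ∀ {w k} → toℕ w ≡ k → Cπ π (fromℕ (suc n)) ≡ w ⇔ oneLine π (suc n) ≡ k
  Cπ-fromℕ≡⇔ refl rewrite Xn-fromℕ (suc n) | Yπ-zero = mk⇔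
    (λ e → trans oneLine-last (cong toℕ e))
    (λ e → toℕ-injective (trans (sym oneLine-last) e))
    where
    oneLine-last : oneLine π (suc n) ≡ toℕ (entryF π (fromℕ n))
    oneLine-last = trans (cong (oneLine π ∘ suc) (sym (toℕ-fromℕ n))) (oneLine-entryF π (fromℕ n))

  Cπ-inject₁≡zero⇔ : ∀ {v k} → toℕ v ≡ k → Cπ π (inject₁ v) ≡ zero ⇔ oneLine π 1 ≡ suc k
  Cπ-inject₁≡zero⇔ {v} refl rewrite Xn-inject₁ (suc n) v =
    ⇔-trans (Yπ-suc≡zero⇔ v) (mk⇔ (cong toℕ) toℕ-injective)

  Cπ-inject₁≡⇔ : ∀ {v w k l} → w ≢ zero → toℕ v ≡ k → toℕ w ≡ l →
    Cπ π (inject₁ v) ≡ w ⇔ (∃ λ i → 1 ≤ i × i < suc n × oneLine π i ≡ l × oneLine π (suc i) ≡ suc k)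
  Cπ-inject₁≡⇔ {v} w≢0 refl refl rewrite Xn-inject₁ (suc n) v = ⇔-trans (Yπ-suc≡⇔ w≢0) adjacent⇔

data PathTo0 {M} (f : Fin (suc M) → Fin (suc M)) : Fin (suc M) → List (Fin (suc M)) → Set where
  done : PathTo0 f zero []
  step : ∀ {y l} → PathTo0 f (f (suc y)) l → PathTo0 f (suc y) (suc y ∷ l)

module _ {M : ℕ} {f : Fin (suc M) → Fin (suc M)} where

  walkTo0-sound : ∀ fuel {x l} → walkTo0 f fuel x ≡ just l → PathTo0 f x l
  walkTo0-sound (suc fuel) {zero} refl = done
  walkTo0-sound (suc fuel) {suc y} eq with walkTo0 f fuel (f (suc y)) in walk
  walkTo0-sound (suc fuel) {suc y} refl | just _ = step (walkTo0-sound fuel walk)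

  walkTo0-complete : ∀ fuel {x l} → PathTo0 f x l → length l < fuel → walkTo0 f fuel x ≡ just l
  walkTo0-complete (suc fuel) done     _          = refl
  walkTo0-complete (suc fuel) (step p) (s≤s len<) rewrite walkTo0-complete fuel p len< = refl

  pathTo0-[]⁻ : ∀ {x} → PathTo0 f x [] → x ≡ zero
  pathTo0-[]⁻ done = refl

  pathTo0-∷⁻ : ∀ {x z l} → PathTo0 f x (z ∷ l) → x ≡ z × PathTo0 f (f z) l
  pathTo0-∷⁻ (step p) = refl , p

  pathTo0-∷⁺ : ∀ {z l} → z ≢ zero → PathTo0 f (f z) l → PathTo0 f z (z ∷ l)
  pathTo0-∷⁺ {zero}  z≢0 _ = contradiction refl z≢0
  pathTo0-∷⁺ {suc y} _   p = step p

  pathTo0-tabulate⁻ : ∀ {m x} (c : Fin (suc m) → Fin (suc M)) → PathTo0 f x (tabulate c) →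
    x ≡ c zero × (∀ j → f (c (inject₁ j)) ≡ c (suc j)) × f (c (fromℕ m)) ≡ zero
  pathTo0-tabulate⁻ {zero} c p with pathTo0-∷⁻ p
  ... | x≡c₀ , p′ = x≡c₀ , (λ ()) , pathTo0-[]⁻ p′
  pathTo0-tabulate⁻ {suc m} c p with pathTo0-∷⁻ p
  ... | x≡c₀ , p′ with pathTo0-tabulate⁻ (c ∘ suc) p′
  ...   | f-c₀ , f-steps , f-last = x≡c₀ , (λ { zero → f-c₀ ; (suc j) → f-steps j }) , f-last

  pathTo0-tabulate⁺ : ∀ {m x} (c : Fin (suc m) → Fin (suc M)) → (∀ j → c j ≢ zero) →
    x ≡ c zero × (∀ j → f (c (inject₁ j)) ≡ c (suc j)) × f (c (fromℕ m)) ≡ zero →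
    PathTo0 f x (tabulate c)
  pathTo0-tabulate⁺ {zero}  c c≢0 (refl , _ , f-last) =
    pathTo0-∷⁺ (c≢0 zero) (subst (λ y → PathTo0 f y []) (sym f-last) done)
  pathTo0-tabulate⁺ {suc m} c c≢0 (refl , f-steps , f-last) =
    pathTo0-∷⁺ (c≢0 zero) (pathTo0-tabulate⁺ (c ∘ suc) (c≢0 ∘ suc) (f-steps zero , f-steps ∘ suc , f-last))

  pathTo0-tabulate : ∀ {m x} (c : Fin (suc m) → Fin (suc M)) → (∀ j → c j ≢ zero) →
    PathTo0 f x (tabulate c) ⇔
    (x ≡ c zero × (∀ j → f (c (inject₁ j)) ≡ c (suc j)) × f (c (fromℕ m)) ≡ zero)
  pathTo0-tabulate c c≢0 = mk⇔ (pathTo0-tabulate⁻ c) (pathTo0-tabulate⁺ c c≢0)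

SPstar-≡⇔PathTo0 : ∀ {n L} (π : Permutation′ n) (l : List (Fin (suc n))) →
  map toℕ l ≡ L → l ≢ [] → length l ≤ n →
  SPstar π ≡ L ⇔ PathTo0 (Cπ π) (Cπ π (fromℕ n)) l
SPstar-≡⇔PathTo0 π []      refl []≢[] _     = contradiction refl []≢[]
SPstar-≡⇔PathTo0 {n} π l@(_ ∷ _) refl _ len≤n = mk⇔ ⇒ ⇐
  where
  ⇒ : SPstar π ≡ map toℕ l → PathTo0 (Cπ π) (Cπ π (fromℕ n)) l
  ⇒ sp with walkTo0 (Cπ π) (suc n) (Cπ π (fromℕ n)) in walk
  ... | just l′ = subst (PathTo0 (Cπ π) _) (map-injective toℕ-injective sp) (walkTo0-sound (suc n) walk)
  ⇒ () | nothing
  ⇐ : PathTo0 (Cπ π) (Cπ π (fromℕ n)) l → SPstar π ≡ map toℕ l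
  ⇐ p rewrite walkTo0-complete (suc n) p (s≤s len≤n) = refl

proposition4p1 : (n : ℕ) (π : Permutation′ n) (m : ℕ) (b : Fin (suc m) → ℕ) →
    Injective _≡_ _≡_ b →
    (∀ j → 1 ≤ b j × b j ≤ n ∸ 1) →
    (SPstar π ≡ tabulate b) ⇔
      ((oneLine π 1 ≡ suc (b (fromℕ m)))
       × (oneLine π n ≡ b zero)
       × (∀ (j : Fin m) → ∃ λ i → 1 ≤ i × i < n
            × oneLine π i ≡ b (suc j) × oneLine π (suc i) ≡ suc (b (inject₁ j))))
proposition4p1 zero π m b b-inj b-range =
  contradiction (≤-trans (proj₁ (b-range zero)) (proj₂ (b-range zero))) λ ()
proposition4p1 (suc n) π m b b-inj b-range =
  ⇔-trans (SPstar-≡⇔PathTo0 π (tabulate vertex) toℕ-vertices (λ ()) length-vertices)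
  (⇔-trans (pathTo0-tabulate vertex vertex≢0) (mk⇔
    (λ (first , steps , last) → to last⇔ last , to first⇔ first , λ j → to (step⇔ j) (steps j))
    (λ (last , first , steps) → from first⇔ first , (λ j → from (step⇔ j) (steps j)) , from last⇔ last)))
  where
  c : Fin (suc m) → Fin (suc n)
  c j = fromℕ< (s≤s (proj₂ (b-range j)))
  vertex : Fin (suc m) → Fin (suc (suc n))
  vertex = inject₁ ∘ c
  toℕ-c : ∀ j → toℕ (c j) ≡ b j
  toℕ-c j = toℕ-fromℕ< _
  toℕ-vertex : ∀ j → toℕ (vertex j) ≡ b j
  toℕ-vertex j = trans (toℕ-inject₁ (c j)) (toℕ-c j)
  toℕ-vertices : map toℕ (tabulate vertex) ≡ tabulate b
  toℕ-vertices = trans (map-tabulate vertex toℕ) (tabulate-cong toℕ-vertex)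
  length-vertices : length (tabulate vertex) ≤ suc n
  length-vertices = subst (_≤ suc n) (sym (length-tabulate vertex)) (injective⇒≤ λ {i} {j} e →
    b-inj (trans (sym (toℕ-c i)) (trans (cong toℕ e) (toℕ-c j))))
  vertex≢0 : ∀ j → vertex j ≢ zero
  vertex≢0 j e with subst (1 ≤_) (trans (sym (toℕ-vertex j)) (cong toℕ e)) (proj₁ (b-range j))
  ... | ()
  first⇔ : Cπ π (fromℕ (suc n)) ≡ vertex zero ⇔ oneLine π (suc n) ≡ b zero
  first⇔ = Cπ-fromℕ≡⇔ π (toℕ-vertex zero)
  step⇔ : ∀ j → Cπ π (vertex (inject₁ j)) ≡ vertex (suc j) ⇔
    (∃ λ i → 1 ≤ i × i < suc n × oneLine π i ≡ b (suc j) × oneLine π (suc i) ≡ suc (b (inject₁ j)))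
  step⇔ j = Cπ-inject₁≡⇔ π (vertex≢0 (suc j)) (toℕ-c (inject₁ j)) (toℕ-vertex (suc j))
  last⇔ : Cπ π (vertex (fromℕ m)) ≡ zero ⇔ oneLine π 1 ≡ suc (b (fromℕ m))
  last⇔ = Cπ-inject₁≡zero⇔ π (toℕ-c (fromℕ m))
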